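{- Let $\mathscr{M}=(S,\rho)$ be a matroid scheme. Its set of circuits $C(\mathscr{M})$ satisfies: (C1) $\hat0\notin C(\mathscr{M})$; (C2) if $x,y\in C(\mathscr{M})$ and $x\le y$ then $x=y$; (C3) if $x,y\in C(\mathscr{M})$ with $x\ne y$, $u\in x\vee y$, and $a\in\mathrm{at}(S)$ with $a\le x\wedge y$, then there exists $z\in C(\mathscr{M})$ with $z\le u$ and $z\not\ge a$.
   Context: A finite poset $S$ is a simplicial poset if it has a unique minimum $\hat0$, is ranked, and each $S_{\le x}$ is isomorphic to the Boolean lattice of subsets of the atoms below $x$; $|x|$ is the rank, $\mathrm{at}(S)$ the atoms. $x\vee y$ / $x\wedge y$ are the sets of minimal common upper / maximal common lower bounds ($x\wedge y$ is a single element when $x\vee y\neq\emptyset$). A matroid scheme is $(S,\rho)$, $\rho:S\to\mathbb{Z}_{\ge0}$, with (M1) $0\le\rho(x)\le|x|$; (M2) monotone; (M3) $u\in x\vee y\Rightarrow\rho(x)+\rho(y)\ge\rho(u)+\rho(x\wedge y)$; (M4) $\ell\in x\wedge y,\ \rho(x)=\rho(\ell)\Rightarrow x\vee y\neq\emptyset$; (M5) $\rho(x)<\rho(y)\Rightarrow$ there is an atom $a\le y$, $a\not\le x$, $x\vee a\ne\emptyset$. $C(\mathscr{M})$ is the set of minimal elements of $\{x\in S:\rho(x)<|x|\}$. -}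

module Defs where

open import Data.Nat using (ℕ; zero; suc; _+_; _≤_; _<_)
open import Data.Fin using (Fin)
open import Data.Fin.Subset using (Subset; _∈_; _⊆_)
open import Data.Product using (Σ; ∃; ∃-syntax; _×_; _,_)
open import Data.Sum using (_⊎_)
open import Relation.Nullary using (¬_)
open import Relation.Binary.PropositionalEquality using (_≡_; _≢_)
open import Relation.Binary.Structures using (IsPartialOrder)
open import Function.Bundles using (_⇔_)

-- A finite simplicial poset, with carrier Fin n (every finite poset is
-- isomorphic to one on Fin n).
record SimplicialPoset : Set₁ where
  field
    n     : ℕ
    _≼_   : Fin n → Fin n → Set
    isPartialOrder : IsPartialOrder _≡_ _≼_
    bot   : Fin n
    bot-min : ∀ x → bot ≼ x

  _⋖_ : Fin n → Fin n → Set
  x ⋖ y = x ≼ y × x ≢ y × (∀ z → x ≼ z → z ≼ y → z ≡ x ⊎ z ≡ y)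

  IsAtom : Fin n → Set
  IsAtom a = bot ⋖ a

  field
    rank      : Fin n → ℕ
    rank-bot  : rank bot ≡ 0
    rank-cover : ∀ x y → x ⋖ y → rank y ≡ suc (rank x)
    -- Boolean intervals: S_{≤x} is order-isomorphic to the Boolean lattice
    -- of subsets of the atoms below x (via some map φ x)
    φ : Fin n → Fin n → Subset n
    φ-into : ∀ x y → y ≼ x → ∀ a → a ∈ φ x y → IsAtom a × a ≼ x
    φ-order : ∀ x y y′ → y ≼ x → y′ ≼ x → (y ≼ y′ ⇔ φ x y ⊆ φ x y′)
    φ-onto : ∀ x (A : Subset n) → (∀ a → a ∈ A → IsAtom a × a ≼ x) →
             ∃[ y ] (y ≼ x × φ x y ≡ A)

module _ (S : SimplicialPoset) where
  open SimplicialPoset S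

  _∈Join_,_ : Fin n → Fin n → Fin n → Set
  u ∈Join x , y = (x ≼ u × y ≼ u) ×
                  (∀ w → x ≼ w → y ≼ w → w ≼ u → w ≡ u)

  _∈Meet_,_ : Fin n → Fin n → Fin n → Set
  ℓ ∈Meet x , y = (ℓ ≼ x × ℓ ≼ y) ×
                  (∀ w → w ≼ x → w ≼ y → ℓ ≼ w → w ≡ ℓ)

  JoinNonempty : Fin n → Fin n → Set
  JoinNonempty x y = ∃[ u ] (u ∈Join x , y)

  record IsMatroidScheme (ρ : Fin n → ℕ) : Set where
    field
      M1 : ∀ x → ρ x ≤ rank x
      M2 : ∀ x y → x ≼ y → ρ x ≤ ρ y
      M3 : ∀ x y u ℓ → u ∈Join x , y → ℓ ∈Meet x , y →
           ρ u + ρ ℓ ≤ ρ x + ρ y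
      M4 : ∀ x y ℓ → ℓ ∈Meet x , y → ρ x ≡ ρ ℓ → JoinNonempty x y
      M5 : ∀ x y → ρ x < ρ y →
           ∃[ a ] (IsAtom a × a ≼ y × ¬ (a ≼ x) × JoinNonempty x a)

  IsCircuit : (Fin n → ℕ) → Fin n → Set
  IsCircuit ρ x = ρ x < rank x × (∀ z → z ≼ x → ρ z < rank z → z ≡ x)

-- Below any element t, the map y ↦ φ t y identifies the interval [0̂, t] with
-- the Boolean lattice of atoms of t, so ranks are cardinalities of atom sets,
-- joins and meets of elements below t correspond to unions and intersections,
-- and rank is modular: |u| + |ℓ| = |x| + |y| for u ∈ x ∨ y, ℓ ∈ x ∧ y.
-- For distinct circuits x, y the meet ℓ lies strictly below x, hence is
-- independent, and (M3) together with modularity gives ρ(u) ≤ |u| − 2.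
-- Removing the atom a from u yields a coatom w of [0̂, u] with ρ(w) ≤ ρ(u)
-- < |w|, so w is dependent and contains a circuit, which avoids a.
module Submission where

open import Defs
open import Data.Nat using (ℕ; zero; suc; _+_; _≤_; _<_; s≤s)
open import Data.Nat.Properties
  using (+-suc; +-cancelʳ-≤; +-monoʳ-≤; +-mono-≤; ≤-refl; ≤-trans; ≤-pred; ≮⇒≥; n≮0; _<?_; suc-injective; module ≤-Reasoning)
open import Data.Fin using (Fin; zero; suc; _≟_)
open import Data.Fin.Subset
  using (Subset; _∈_; _∉_; _⊆_; _⊂_; _∩_; _∪_; _-_; ∣_∣; ⁅_⁆; Nonempty; inside; outside)
open import Data.Fin.Subset.Properties
  using (_∈?_; _⊂?_; anySubset?; nonempty?; Empty-unique; ∣⊥∣≡0; p─⊥≡p; p─q⊆p; x∈p∧x≢y⇒x∈p-y;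
         x∈p⇒∣p-x∣<∣p∣; ⊆-antisym; p∩q⊆p; p∩q⊆q; x∈p∩q⁺; p⊆p∪q; q⊆p∪q; x∈p∪q⁻; p⊂q⇒∣p∣<∣q∣)
open import Data.Vec using ([]; _∷_; here; there)
open import Data.Product using (∃-syntax; _×_; _,_; proj₁; proj₂)
open import Data.Sum using (_⊎_; inj₁; inj₂; [_,_]′)
import Data.Sum as Sum
open import Data.Empty using (⊥-elim)
open import Relation.Nullary using (¬_; yes; no)
open import Relation.Nullary.Decidable using (_×-dec_)
open import Relation.Binary.PropositionalEquality
  using (_≡_; _≢_; refl; sym; trans; cong; cong₂; subst; module ≡-Reasoning)
open import Relation.Binary.Structures using (IsPartialOrder)
open import Function.Bundles using (Equivalence)

private variable
  m : ℕ

x∈p⇒suc∣p-x∣≡∣p∣ : {p : Subset m} {x : Fin m} → x ∈ p → suc ∣ p - x ∣ ≡ ∣ p ∣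
x∈p⇒suc∣p-x∣≡∣p∣ {p = inside ∷ p}  {zero}  here      = cong (λ q → suc ∣ q ∣) (p─⊥≡p p)
x∈p⇒suc∣p-x∣≡∣p∣ {p = outside ∷ p} {suc x} (there h) = x∈p⇒suc∣p-x∣≡∣p∣ h
x∈p⇒suc∣p-x∣≡∣p∣ {p = inside ∷ p}  {suc x} (there h) = cong suc (x∈p⇒suc∣p-x∣≡∣p∣ h)

x∉p-x : (p : Subset m) (x : Fin m) → x ∉ p - x
x∉p-x (_ ∷ p) (suc x) (there h) = x∉p-x p x h

∣p∪q∣+∣p∩q∣≡∣p∣+∣q∣ : (p q : Subset m) → ∣ p ∪ q ∣ + ∣ p ∩ q ∣ ≡ ∣ p ∣ + ∣ q ∣
∣p∪q∣+∣p∩q∣≡∣p∣+∣q∣ [] [] = refl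
∣p∪q∣+∣p∩q∣≡∣p∣+∣q∣ (inside ∷ p) (inside ∷ q) = cong suc (begin
  ∣ p ∪ q ∣ + suc ∣ p ∩ q ∣  ≡⟨ +-suc ∣ p ∪ q ∣ ∣ p ∩ q ∣ ⟩
  suc (∣ p ∪ q ∣ + ∣ p ∩ q ∣) ≡⟨ cong suc (∣p∪q∣+∣p∩q∣≡∣p∣+∣q∣ p q) ⟩
  suc (∣ p ∣ + ∣ q ∣)         ≡⟨ +-suc ∣ p ∣ ∣ q ∣ ⟨
  ∣ p ∣ + suc ∣ q ∣           ∎)
  where open ≡-Reasoning
∣p∪q∣+∣p∩q∣≡∣p∣+∣q∣ (inside ∷ p) (outside ∷ q) = cong suc (∣p∪q∣+∣p∩q∣≡∣p∣+∣q∣ p q)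
∣p∪q∣+∣p∩q∣≡∣p∣+∣q∣ (outside ∷ p) (inside ∷ q) =
  trans (cong suc (∣p∪q∣+∣p∩q∣≡∣p∣+∣q∣ p q)) (sym (+-suc ∣ p ∣ ∣ q ∣))
∣p∪q∣+∣p∩q∣≡∣p∣+∣q∣ (outside ∷ p) (outside ∷ q) = ∣p∪q∣+∣p∩q∣≡∣p∣+∣q∣ p q

∣p∣≡suc⇒Nonempty : {p : Subset m} {k : ℕ} → ∣ p ∣ ≡ suc k → Nonempty p
∣p∣≡suc⇒Nonempty {m = m} {p = p} e with nonempty? p
... | yes ne = ne
... | no ¬ne with trans (sym e) (trans (cong ∣_∣ (Empty-unique ¬ne)) (∣⊥∣≡0 m))
... | ()

∣p∣≡0⇒x∉p : {p : Subset m} {x : Fin m} → ∣ p ∣ ≡ 0 → x ∉ p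
∣p∣≡0⇒x∉p {p = p} {x} e x∈p = n≮0 (subst (∣ p - x ∣ <_) e (x∈p⇒∣p-x∣<∣p∣ x∈p))

p⊆q⇒p∩q≡p : {p q : Subset m} → p ⊆ q → p ∩ q ≡ p
p⊆q⇒p∩q≡p {p = p} {q} p⊆q = ⊆-antisym (p∩q⊆p p q) (λ h → x∈p∩q⁺ (h , p⊆q h))

p⊆q∧p⊄q⇒q⊆p : {p q : Subset m} → p ⊆ q → ¬ (p ⊂ q) → q ⊆ p
p⊆q∧p⊄q⇒q⊆p {p = p} p⊆q p⊄q {x} x∈q with x ∈? p
... | yes x∈p = x∈p
... | no  x∉p = ⊥-elim (p⊄q (p⊆q , x , x∈q , x∉p))

p-x⊆q⊆p⇒q⊆p-x⊎p⊆q : {p q : Subset m} {x : Fin m} → p - x ⊆ q → q ⊆ p → q ⊆ p - x ⊎ p ⊆ q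
p-x⊆q⊆p⇒q⊆p-x⊎p⊆q {p = p} {q} {x} p-x⊆q q⊆p with x ∈? q
... | yes x∈q = inj₂ p⊆q
  where
  p⊆q : p ⊆ q
  p⊆q {c} c∈p with c ≟ x
  ... | yes refl = x∈q
  ... | no  c≢x  = p-x⊆q (x∈p∧x≢y⇒x∈p-y c∈p c≢x)
... | no x∉q = inj₁ λ {c} c∈q → x∈p∧x≢y⇒x∈p-y (q⊆p c∈q) λ { refl → x∉q c∈q }

module SimplicialPosetProperties (S : SimplicialPoset) where
  open SimplicialPoset S
  open IsPartialOrder isPartialOrder public using (antisym) renaming (trans to ≼-trans; reflexive to ≼-reflexive)

  ≼-refl : ∀ {x} → x ≼ x
  ≼-refl = ≼-reflexive refl

  module Interval (t : Fin n) where

    ≼⇒⊆ : ∀ {y y′} → y ≼ t → y′ ≼ t → y ≼ y′ → φ t y ⊆ φ t y′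
    ≼⇒⊆ {y} {y′} y≼t y′≼t = Equivalence.to (φ-order t y y′ y≼t y′≼t)

    ⊆⇒≼ : ∀ {y y′} → y ≼ t → y′ ≼ t → φ t y ⊆ φ t y′ → y ≼ y′
    ⊆⇒≼ {y} {y′} y≼t y′≼t = Equivalence.from (φ-order t y y′ y≼t y′≼t)

    φ-injective : ∀ {y y′} → y ≼ t → y′ ≼ t → φ t y ≡ φ t y′ → y ≡ y′
    φ-injective y≼t y′≼t e =
      antisym (⊆⇒≼ y≼t y′≼t (λ h → subst (_ ∈_) e h)) (⊆⇒≼ y′≼t y≼t (λ h → subst (_ ∈_) (sym e) h))

    φ⊆φ-top : ∀ {y} → y ≼ t → φ t y ⊆ φ t t
    φ⊆φ-top y≼t = ≼⇒⊆ y≼t ≼-refl y≼t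

    -- A is intersected with the atoms of t so that every subset names a face.
    private
      realise : (A : Subset n) → ∃[ y ] (y ≼ t × φ t y ≡ A ∩ φ t t)
      realise A = φ-onto t (A ∩ φ t t) (λ a a∈ → φ-into t t ≼-refl a (p∩q⊆q A (φ t t) a∈))

    face : Subset n → Fin n
    face A = proj₁ (realise A)

    face≼ : ∀ A → face A ≼ t
    face≼ A = proj₁ (proj₂ (realise A))

    φ-face-∩ : ∀ A → φ t (face A) ≡ A ∩ φ t t
    φ-face-∩ A = proj₂ (proj₂ (realise A))

    φ-face : ∀ {A} → A ⊆ φ t t → φ t (face A) ≡ A
    φ-face {A} A⊆ = trans (φ-face-∩ A) (p⊆q⇒p∩q≡p A⊆)

    φ-face-remove : ∀ {y b} → y ≼ t → φ t (face (φ t y - b)) ≡ φ t y - b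
    φ-face-remove {y} {b} y≼t = φ-face (λ h → φ⊆φ-top y≼t (p─q⊆p (φ t y) ⁅ b ⁆ h))

    face-φ : ∀ {y} → y ≼ t → face (φ t y) ≡ y
    face-φ {y} y≼t = φ-injective (face≼ _) y≼t (φ-face (φ⊆φ-top y≼t))

    ≼-face : ∀ {y A} → y ≼ t → φ t y ⊆ A → y ≼ face A
    ≼-face {y} {A} y≼t y⊆A = ⊆⇒≼ y≼t (face≼ A) λ h →
      subst (_ ∈_) (sym (φ-face-∩ A)) (x∈p∩q⁺ (y⊆A h , φ⊆φ-top y≼t h))

    face-≼ : ∀ {y A} → y ≼ t → A ⊆ φ t y → face A ≼ y
    face-≼ {y} {A} y≼t A⊆y = ⊆⇒≼ (face≼ A) y≼t λ h →
      A⊆y (p∩q⊆p A (φ t t) (subst (_ ∈_) (φ-face-∩ A) h))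

    face-remove-⋖ : ∀ {y b} → y ≼ t → b ∈ φ t y → face (φ t y - b) ⋖ y
    face-remove-⋖ {y} {b} y≼t b∈y = y′≼y , y′≢y , between
      where
      y′ = face (φ t y - b)
      y′≼t = face≼ (φ t y - b)
      φy′ = φ-face-remove {b = b} y≼t
      y′≼y : y′ ≼ y
      y′≼y = face-≼ y≼t (p─q⊆p (φ t y) ⁅ b ⁆)
      y′≢y : y′ ≢ y
      y′≢y e = x∉p-x (φ t y) b (subst (b ∈_) φy′ (subst (λ z → b ∈ φ t z) (sym e) b∈y))
      between : ∀ z → y′ ≼ z → z ≼ y → z ≡ y′ ⊎ z ≡ y
      between z y′≼z z≼y =
        Sum.map z≡y′ z≡y (p-x⊆q⊆p⇒q⊆p-x⊎p⊆q (λ h → ≼⇒⊆ y′≼t z≼t y′≼z (subst (_ ∈_) (sym φy′) h)) (≼⇒⊆ z≼t y≼t z≼y))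
        where
        z≼t = ≼-trans z≼y y≼t
        z≡y′ : φ t z ⊆ φ t y - b → z ≡ y′
        z≡y′ z⊆y-b = antisym (⊆⇒≼ z≼t y′≼t λ h → subst (_ ∈_) (sym φy′) (z⊆y-b h)) y′≼z
        z≡y : φ t y ⊆ φ t z → z ≡ y
        z≡y y⊆z = antisym z≼y (⊆⇒≼ y≼t z≼t y⊆z)

    -- Induction on the number of atoms: removing one atom gives a cover.
    rank≡∣φ∣ : ∀ {y} → y ≼ t → rank y ≡ ∣ φ t y ∣
    rank≡∣φ∣ y≼t = go _ y≼t refl
      where
      go : ∀ k {y} → y ≼ t → ∣ φ t y ∣ ≡ k → rank y ≡ k
      go zero {y} y≼t e = trans (cong rank y≡bot) rank-bot
        where
        y≡bot : y ≡ bot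
        y≡bot = antisym (⊆⇒≼ y≼t (bot-min t) λ h → ⊥-elim (∣p∣≡0⇒x∉p e h)) (bot-min y)
      go (suc k) {y} y≼t e with ∣p∣≡suc⇒Nonempty e
      ... | b , b∈y = trans (rank-cover _ y (face-remove-⋖ y≼t b∈y)) (cong suc (go k (face≼ _) ∣y-b∣≡k))
        where
        ∣y-b∣≡k : ∣ φ t (face (φ t y - b)) ∣ ≡ k
        ∣y-b∣≡k = suc-injective (begin
          suc ∣ φ t (face (φ t y - b)) ∣ ≡⟨ cong (λ A → suc ∣ A ∣) (φ-face-remove y≼t) ⟩
          suc ∣ φ t y - b ∣              ≡⟨ x∈p⇒suc∣p-x∣≡∣p∣ b∈y ⟩
          ∣ φ t y ∣                       ≡⟨ e ⟩
          suc k                           ∎)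
          where open ≡-Reasoning

    ∣φ-atom∣≡1 : ∀ {a} → IsAtom a → a ≼ t → ∣ φ t a ∣ ≡ 1
    ∣φ-atom∣≡1 {a} atom a≼t = trans (sym (rank≡∣φ∣ a≼t)) (trans (rank-cover bot a atom) (cong suc rank-bot))

    ∃-coatom-avoiding : ∀ {a} → IsAtom a → a ≼ t → ∃[ w ] (w ⋖ t × ¬ (a ≼ w))
    ∃-coatom-avoiding {a} atom a≼t with ∣p∣≡suc⇒Nonempty (∣φ-atom∣≡1 atom a≼t)
    ... | c , c∈a = face (φ t t - c) , face-remove-⋖ ≼-refl (φ⊆φ-top a≼t c∈a) , a⋠w
      where
      a⋠w : ¬ (a ≼ face (φ t t - c))
      a⋠w a≼w = x∉p-x (φ t t) c (subst (c ∈_) (φ-face-remove ≼-refl) (≼⇒⊆ a≼t (face≼ _) a≼w c∈a))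

    rank-face-< : ∀ {A} → A ⊂ φ t t → rank (face A) < rank t
    rank-face-< {A} A⊂ = begin-strict
      rank (face A)      ≡⟨ rank≡∣φ∣ (face≼ A) ⟩
      ∣ φ t (face A) ∣   ≡⟨ cong ∣_∣ (φ-face (proj₁ A⊂)) ⟩
      ∣ A ∣              <⟨ p⊂q⇒∣p∣<∣q∣ A⊂ ⟩
      ∣ φ t t ∣          ≡⟨ rank≡∣φ∣ ≼-refl ⟨
      rank t             ∎
      where open ≤-Reasoning

  rank-join : ∀ {u x y} → _∈Join_,_ S u x y → rank u ≡ ∣ φ u x ∪ φ u y ∣
  rank-join {u} {x} {y} ((x≼u , y≼u) , minimal) = begin
    rank u          ≡⟨ cong rank (sym u′≡u) ⟩
    rank u′         ≡⟨ rank≡∣φ∣ (face≼ X∪Y) ⟩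
    ∣ φ u u′ ∣      ≡⟨ cong ∣_∣ (φ-face X∪Y⊆U) ⟩
    ∣ X∪Y ∣         ∎
    where
    open Interval u
    open ≡-Reasoning
    X∪Y = φ u x ∪ φ u y
    u′ = face X∪Y
    X∪Y⊆U : X∪Y ⊆ φ u u
    X∪Y⊆U h = [ φ⊆φ-top x≼u , φ⊆φ-top y≼u ]′ (x∈p∪q⁻ (φ u x) (φ u y) h)
    u′≡u : u′ ≡ u
    u′≡u = minimal u′ (≼-face x≼u (p⊆p∪q (φ u y))) (≼-face y≼u (q⊆p∪q (φ u x) (φ u y))) (face≼ X∪Y)

  rank-meet : ∀ {t ℓ x y} → x ≼ t → y ≼ t → _∈Meet_,_ S ℓ x y → rank ℓ ≡ ∣ φ t x ∩ φ t y ∣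
  rank-meet {t} {ℓ} {x} {y} x≼t y≼t ((ℓ≼x , ℓ≼y) , maximal) = begin
    rank ℓ          ≡⟨ cong rank (sym ℓ′≡ℓ) ⟩
    rank ℓ′         ≡⟨ rank≡∣φ∣ (face≼ X∩Y) ⟩
    ∣ φ t ℓ′ ∣      ≡⟨ cong ∣_∣ (φ-face (λ h → φ⊆φ-top x≼t (p∩q⊆p (φ t x) (φ t y) h))) ⟩
    ∣ X∩Y ∣         ∎
    where
    open Interval t
    open ≡-Reasoning
    X∩Y = φ t x ∩ φ t y
    ℓ′ = face X∩Y
    ℓ≼t = ≼-trans ℓ≼x x≼t
    ℓ′≡ℓ : ℓ′ ≡ ℓ
    ℓ′≡ℓ = maximal ℓ′ (face-≼ x≼t (p∩q⊆p (φ t x) (φ t y))) (face-≼ y≼t (p∩q⊆q (φ t x) (φ t y)))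
                    (≼-face ℓ≼t λ h → x∈p∩q⁺ (≼⇒⊆ ℓ≼t x≼t ℓ≼x h , ≼⇒⊆ ℓ≼t y≼t ℓ≼y h))

  rank-modular : ∀ {u ℓ x y} → _∈Join_,_ S u x y → _∈Meet_,_ S ℓ x y →
                 rank u + rank ℓ ≡ rank x + rank y
  rank-modular {u} {ℓ} {x} {y} join@((x≼u , y≼u) , _) meet = begin
    rank u + rank ℓ                             ≡⟨ cong₂ _+_ (rank-join join) (rank-meet x≼u y≼u meet) ⟩
    ∣ φ u x ∪ φ u y ∣ + ∣ φ u x ∩ φ u y ∣       ≡⟨ ∣p∪q∣+∣p∩q∣≡∣p∣+∣q∣ (φ u x) (φ u y) ⟩
    ∣ φ u x ∣ + ∣ φ u y ∣                       ≡⟨ cong₂ _+_ (rank≡∣φ∣ x≼u) (rank≡∣φ∣ y≼u) ⟨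
    rank x + rank y                             ∎
    where
    open Interval u
    open ≡-Reasoning

  module Circuits (ρ : Fin n → ℕ) where

    Dependent : Fin n → Set
    Dependent z = ρ z < rank z

    ¬IsCircuit-bot : ¬ IsCircuit S ρ bot
    ¬IsCircuit-bot (dependent , _) = n≮0 (subst (ρ bot <_) rank-bot dependent)

    IsCircuit-≼⇒≡ : ∀ {x y} → IsCircuit S ρ x → IsCircuit S ρ y → x ≼ y → x ≡ y
    IsCircuit-≼⇒≡ (dependent , _) (_ , minimal) x≼y = minimal _ x≼y dependent

    -- _≼_ need not be decidable, so the search for a smaller dependent element
    -- runs over the atom sets of the proper faces of v instead.
    Dependent⇒∃IsCircuit≼ : ∀ {v} → Dependent v → ∃[ z ] (IsCircuit S ρ z × z ≼ v)
    Dependent⇒∃IsCircuit≼ {v} = go (rank v) ≤-refl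
      where
      open Interval using (face; face≼)
      go : ∀ k {v} → rank v ≤ k → Dependent v → ∃[ z ] (IsCircuit S ρ z × z ≼ v)
      go zero r dv = ⊥-elim (n≮0 (≤-trans dv r))
      go (suc k) {v} r dv
        with anySubset? {P = λ B → B ⊂ φ v v × Dependent (face v B)}
                        (λ B → (B ⊂? φ v v) ×-dec (ρ (face v B) <? rank (face v B)))
      ... | yes (B , B⊂ , dB) with go k (≤-pred (≤-trans (Interval.rank-face-< v B⊂) r)) dB
      ...   | z , cz , z≼ = z , cz , ≼-trans z≼ (face≼ v B)
      go (suc k) {v} r dv | no ¬proper = v , (dv , minimal) , ≼-refl
        where
        open Interval v using (⊆⇒≼; φ⊆φ-top; face-φ)
        minimal : ∀ z → z ≼ v → Dependent z → z ≡ v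
        minimal z z≼v dz with φ v z ⊂? φ v v
        ... | yes z⊂v = ⊥-elim (¬proper (φ v z , z⊂v , subst Dependent (sym (face-φ z≼v)) dz))
        ... | no  z⊄v = antisym z≼v (⊆⇒≼ ≼-refl z≼v (p⊆q∧p⊄q⇒q⊆p (φ⊆φ-top z≼v) z⊄v))

module CircuitElimination (S : SimplicialPoset) (ρ : Fin (SimplicialPoset.n S) → ℕ) (M : IsMatroidScheme S ρ) where
  open SimplicialPoset S
  open SimplicialPosetProperties S
  open Circuits ρ
  open IsMatroidScheme M

  2+ρ≤rank-join : ∀ {x y u ℓ} → IsCircuit S ρ x → IsCircuit S ρ y → x ≢ y →
                  _∈Join_,_ S u x y → _∈Meet_,_ S ℓ x y → 2 + ρ u ≤ rank u
  2+ρ≤rank-join {x} {y} {u} {ℓ} cx@(dx , minimal-x) cy@(dy , _) x≢y join meet@((ℓ≼x , ℓ≼y) , _) =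
    +-cancelʳ-≤ (rank ℓ) (2 + ρ u) (rank u) (begin
      2 + ρ u + rank ℓ        ≤⟨ +-monoʳ-≤ (2 + ρ u) ℓ-independent ⟩
      2 + ρ u + ρ ℓ           ≤⟨ s≤s (s≤s (M3 x y u ℓ join meet)) ⟩
      2 + (ρ x + ρ y)         ≡⟨ cong suc (+-suc (ρ x) (ρ y)) ⟨
      suc (ρ x) + suc (ρ y)   ≤⟨ +-mono-≤ dx dy ⟩
      rank x + rank y         ≡⟨ rank-modular join meet ⟨
      rank u + rank ℓ         ∎)
    where
    open ≤-Reasoning
    ℓ-independent : rank ℓ ≤ ρ ℓ
    ℓ-independent = ≮⇒≥ λ dℓ → x≢y (IsCircuit-≼⇒≡ cx cy (subst (_≼ y) (minimal-x ℓ ℓ≼x dℓ) ℓ≼y))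

  IsCircuit-elimination : ∀ {x y u a ℓ} → IsCircuit S ρ x → IsCircuit S ρ y → x ≢ y →
                          _∈Join_,_ S u x y → IsAtom a → _∈Meet_,_ S ℓ x y → a ≼ ℓ →
                          ∃[ z ] (IsCircuit S ρ z × z ≼ u × ¬ (a ≼ z))
  IsCircuit-elimination {u = u} cx cy x≢y join@((x≼u , _) , _) atom meet@((ℓ≼x , _) , _) a≼ℓ
    with Interval.∃-coatom-avoiding u atom (≼-trans a≼ℓ (≼-trans ℓ≼x x≼u))
  ... | w , w⋖u@(w≼u , _) , a⋠w with Dependent⇒∃IsCircuit≼ w-dependent
    where
    -- ρ w ≤ ρ u ≤ rank u − 2 = rank w − 1
    w-dependent : Dependent w
    w-dependent = ≤-pred (≤-trans (s≤s (s≤s (M2 w u w≼u)))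
                                  (subst (2 + ρ u ≤_) (rank-cover w u w⋖u) (2+ρ≤rank-join cx cy x≢y join meet)))
  ...   | z , cz , z≼w = z , cz , ≼-trans z≼w w≼u , λ a≼z → a⋠w (≼-trans a≼z z≼w)

proposition6p8 : (S : SimplicialPoset) (ρ : Fin (SimplicialPoset.n S) → ℕ) →
    IsMatroidScheme S ρ →
    let open SimplicialPoset S in
    (¬ IsCircuit S ρ bot)
    × (∀ x y → IsCircuit S ρ x → IsCircuit S ρ y → x ≼ y → x ≡ y)
    × (∀ x y u a ℓ → IsCircuit S ρ x → IsCircuit S ρ y → x ≢ y →
         _∈Join_,_ S u x y → IsAtom a → _∈Meet_,_ S ℓ x y → a ≼ ℓ →
         ∃[ z ] (IsCircuit S ρ z × z ≼ u × ¬ (a ≼ z)))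
proposition6p8 S ρ M =
    ¬IsCircuit-bot
  , (λ _ _ → IsCircuit-≼⇒≡)
  , (λ _ _ _ _ _ → IsCircuit-elimination)
  where
  open SimplicialPosetProperties.Circuits S ρ
  open CircuitElimination S ρ M
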